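{- Let $G$ be a graph and $G^*$ its active part. If $G'$ is an induced subgraph of $G^*$ with $\deg(G')=\deg(G)>0$, then $G'=G^*$.
   Context: A 2-switch acting on a graph $X$ is given by distinct vertices $a,b,c,d$ with $ab,cd\in E(X)$, $ac,bd\notin E(X)$, and transforms $X$ into $(X-\{ab,cd\})+\{ac,bd\}$. The 2-switch-degree $\deg(X)$ is the number of distinct graphs obtainable from $X$ by a single 2-switch. A vertex $v$ of $G$ is active if it lies in a 4-vertex set $W$ with $\langle W\rangle_G$ isomorphic to $P_4$, $C_4$ or $2K_2$ (equivalently, some 2-switch acting on $G$ involves $v$). The active part $G^*$ is the subgraph of $G$ induced by its active vertices. -}

module Defs where

open import Data.Nat using (ℕ; zero; suc)
open import Data.Bool using (Bool; true; false; if_then_else_; _∧_; _∨_)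
open import Data.Bool.Properties using () renaming (_≟_ to _≟ᵇ_)
open import Data.Fin using (Fin; zero; suc)
open import Data.Fin.Properties using () renaming (_≟_ to _≟ᶠ_)
open import Data.Fin.Subset using (Subset; _∈_; ⊤)
open import Data.Fin.Subset.Properties using (_∈?_)
open import Data.List using (List; []; _∷_; length; filter; map; concatMap; deduplicate)
open import Data.List.Properties using (≡-dec)
open import Data.List using (allFin)
open import Data.Product using (Σ; ∃; _×_; _,_)
open import Data.Sum using (_⊎_)
open import Relation.Binary.PropositionalEquality using (_≡_; _≢_)
open import Relation.Nullary using (Dec; yes; no; ¬_)
open import Relation.Nullary.Decidable using (⌊_⌋; _×-dec_)
open import Function.Definitions using (Injective)

record Graph (n : ℕ) : Set where
  field
    adj    : Fin n → Fin n → Bool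
    sym    : ∀ x y → adj x y ≡ adj y x
    irrefl : ∀ x → adj x x ≡ false
open Graph public

Adj : ℕ → Set
Adj n = Fin n → Fin n → Bool

samePair : ∀ {n} → Fin n → Fin n → Fin n → Fin n → Bool
samePair x y p q = (⌊ x ≟ᶠ p ⌋ ∧ ⌊ y ≟ᶠ q ⌋) ∨ (⌊ x ≟ᶠ q ⌋ ∧ ⌊ y ≟ᶠ p ⌋)

switch : ∀ {n} → Graph n → Fin n → Fin n → Fin n → Fin n → Adj n
switch G a b c d x y =
  if samePair x y a b ∨ samePair x y c d then false
  else if samePair x y a c ∨ samePair x y b d then true
  else adj G x y

ValidSwitch : ∀ {n} → Graph n → Fin n → Fin n → Fin n → Fin n → Set
ValidSwitch G a b c d =
  a ≢ b × a ≢ c × a ≢ d × b ≢ c × b ≢ d × c ≢ d ×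
  adj G a b ≡ true × adj G c d ≡ true × adj G a c ≡ false × adj G b d ≡ false

neq? : ∀ {n} (x y : Fin n) → Dec (x ≢ y)
neq? x y with x ≟ᶠ y
... | yes p = no (λ h → h p)
... | no p = yes p

validSwitch? : ∀ {n} (G : Graph n) a b c d → Dec (ValidSwitch G a b c d)
validSwitch? G a b c d =
  neq? a b ×-dec neq? a c ×-dec neq? a d ×-dec neq? b c ×-dec neq? b d ×-dec neq? c d ×-dec
  (adj G a b ≟ᵇ true) ×-dec (adj G c d ≟ᵇ true) ×-dec (adj G a c ≟ᵇ false) ×-dec (adj G b d ≟ᵇ false)

verts : ∀ {n} → Subset n → List (Fin n)
verts S = filter (_∈? S) (allFin _)

pairs : ∀ {n} → Subset n → List (Fin n × Fin n)
pairs S = concatMap (λ x → map (λ y → (x , y)) (verts S)) (verts S)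

-- a graph on the vertex set S, encoded by its adjacency table on S × S
restrict : ∀ {n} → Subset n → Adj n → List Bool
restrict S H = map (λ { (x , y) → H x y }) (pairs S)

quads : ∀ {n} → Subset n → List (Fin n × Fin n × Fin n × Fin n)
quads S = concatMap (λ a → concatMap (λ b → concatMap (λ c → map (λ d → (a , b , c , d))
            (verts S)) (verts S)) (verts S)) (verts S)

-- all graphs (on vertex set S) obtained from the induced subgraph G[S] by a single
-- 2-switch (a 2-switch of G[S] is exactly a valid 2-switch of G with a,b,c,d ∈ S)
switchResults : ∀ {n} → Subset n → Graph n → List (List Bool)
switchResults S G =
  map (λ { (a , b , c , d) → restrict S (switch G a b c d) })
      (filter (λ { (a , b , c , d) → validSwitch? G a b c d }) (quads S))

degInduced : ∀ {n} → Subset n → Graph n → ℕ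
degInduced S G = length (deduplicate (≡-dec _≟ᵇ_) (switchResults S G))

deg : ∀ {n} → Graph n → ℕ
deg G = degInduced ⊤ G

P4 C4 2K2 : Fin 4 → Fin 4 → Bool
P4 x y = samePair x y zero (suc zero) ∨ samePair x y (suc zero) (suc (suc zero))
         ∨ samePair x y (suc (suc zero)) (suc (suc (suc zero)))
C4 x y = P4 x y ∨ samePair x y (suc (suc (suc zero))) zero
2K2 x y = samePair x y zero (suc zero) ∨ samePair x y (suc (suc zero)) (suc (suc (suc zero)))

-- the subgraph of G induced by the image of the injection w : Fin 4 → Fin n is
-- isomorphic (via w) to the pattern graph P
InducesVia : ∀ {n} → Graph n → (Fin 4 → Fin n) → (Fin 4 → Fin 4 → Bool) → Set
InducesVia G w P = ∀ i j → adj G (w i) (w j) ≡ P i j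

Active : ∀ {n} → Graph n → Fin n → Set
Active G v = Σ (Fin 4 → Fin _) λ w → Injective _≡_ _≡_ w × (∃ λ k → w k ≡ v) ×
  (InducesVia G w P4 ⊎ InducesVia G w C4 ⊎ InducesVia G w 2K2)

-- Let v be an active vertex outside S; some 2-switch σ of G removes an edge at v.
-- Every 2-switch of G[S] is a 2-switch of G, and the resulting graph on S is read off
-- from the resulting graph on V(G), so distinct results of G[S] lift to distinct
-- results of G. None of these lifts equals the result of σ, since switches inside S
-- keep every edge at v. Hence deg G[S] < deg G.
module Submission where

open import Defs hiding (sym)
open import Data.Nat using (ℕ; _<_; z≤n; s≤s)
open import Data.Nat.Properties using (<⇒≢)
open import Data.Fin using (Fin; zero; suc; #_)
open import Data.Fin.Subset using (Subset; _∈_; _∉_; ⊤)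
open import Data.Fin.Subset.Properties using (_∈?_; ∈⊤)
open import Data.Fin.Properties using () renaming (_≟_ to _≟ᶠ_)
open import Data.Bool using (Bool; true; false; if_then_else_; _∨_)
open import Data.Bool.Properties using (∨-zeroʳ; ∧-zeroʳ) renaming (_≟_ to _≟ᵇ_)
open import Data.Product using (∃; ∃-syntax; _×_; _,_)
open import Data.Sum using (_⊎_; inj₁; inj₂)
open import Data.List using (List; []; _∷_; map; allFin; length; deduplicate)
open import Data.List.Properties using (≡-dec; ∷-injective; map-cong; length-removeAt′)
open import Data.List.Relation.Unary.Any as Any using (here; there; index; _─_)
open import Data.List.Relation.Unary.All as All using (All; []; _∷_)
open import Data.List.Relation.Unary.AllPairs using (_∷_)
open import Data.List.Relation.Unary.Unique.Propositional using (Unique)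
open import Data.List.Relation.Unary.Unique.DecPropositional.Properties using (deduplicate-!)
open import Data.List.Membership.Propositional using (find) renaming (_∈_ to _∈ₗ_)
open import Data.List.Membership.Propositional.Properties
open import Function using (_∘_)
open import Function.Definitions using (Injective)
open import Relation.Binary.PropositionalEquality
open import Relation.Nullary using (yes; no; ¬_; contradiction)
open import Relation.Nullary.Decidable using (⌊_⌋)

module _ {A : Set} where

  ∈-─⁺ : ∀ {x z : A} {ys} (p : x ∈ₗ ys) → z ∈ₗ ys → z ≢ x → z ∈ₗ (ys ─ p)
  ∈-─⁺ (here refl) (here refl) z≢x = contradiction refl z≢x
  ∈-─⁺ (here refl) (there q)   _   = q
  ∈-─⁺ (there p)   (here refl) _   = here refl
  ∈-─⁺ (there p)   (there q)   z≢x = there (∈-─⁺ p q z≢x)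

  nonempty-length : ∀ {x : A} {ys} → x ∈ₗ ys → 0 < length ys
  nonempty-length (here _)  = s≤s z≤n
  nonempty-length (there _) = s≤s z≤n

module _ {A B : Set} (R : A → B → Set) where

  Lifted : List B → A → Set
  Lifted ys x = ∃[ y ] y ∈ₗ ys × R x y

  module _ (R-functionalˡ : ∀ {x x' y} → R x y → R x' y → x ≡ x') where

    unique-lifted-length< : ∀ {xs ys y₀} → Unique xs → All (Lifted ys) xs →
      y₀ ∈ₗ ys → All (λ x → ¬ R x y₀) xs → length xs < length ys
    unique-lifted-length< {[]} _ [] y₀∈ys _ = nonempty-length y₀∈ys
    unique-lifted-length< {x ∷ xs} {ys} {y₀} (x∉xs ∷ u) ((y , y∈ys , xRy) ∷ ls) y₀∈ys (¬xRy₀ ∷ ns)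
      rewrite length-removeAt′ ys (index y∈ys) =
      s≤s (unique-lifted-length< u (relift x∉xs ls) (∈-─⁺ y∈ys y₀∈ys y₀≢y) ns)
      where
      y₀≢y : y₀ ≢ y
      y₀≢y refl = ¬xRy₀ xRy

      relift : ∀ {zs} → All (x ≢_) zs → All (Lifted ys) zs → All (Lifted (ys ─ y∈ys)) zs
      relift []           []                          = []
      relift (x≢z ∷ x≢zs) ((y' , y'∈ys , zRy') ∷ ls') =
        (y' , ∈-─⁺ y∈ys y'∈ys (λ { refl → x≢z (R-functionalˡ xRy zRy') }) , zRy') ∷ relift x≢zs ls'

module _ {n} (S : Subset n) where

  ∈-verts⁺ : ∀ {x} → x ∈ S → x ∈ₗ verts S
  ∈-verts⁺ {x} = ∈-filter⁺ (_∈? S) (∈-allFin x)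

  ∈-verts⁻ : ∀ {x} → x ∈ₗ verts S → x ∈ S
  ∈-verts⁻ x∈ = let _ , x∈S = ∈-filter⁻ (_∈? S) {xs = allFin _} x∈ in x∈S

  ∈-pairs⁺ : ∀ {x y} → x ∈ S → y ∈ S → (x , y) ∈ₗ pairs S
  ∈-pairs⁺ x∈S y∈S =
    ∈-concatMap⁺ _ (Any.map (λ { refl → ∈-map⁺ _ (∈-verts⁺ y∈S) }) (∈-verts⁺ x∈S))

  ∈-quads⁺ : ∀ {a b c d} → a ∈ S → b ∈ S → c ∈ S → d ∈ S → (a , b , c , d) ∈ₗ quads S
  ∈-quads⁺ a∈S b∈S c∈S d∈S =
    ∈-concatMap⁺ _ (Any.map (λ { refl →
    ∈-concatMap⁺ _ (Any.map (λ { refl →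
    ∈-concatMap⁺ _ (Any.map (λ { refl → ∈-map⁺ _ (∈-verts⁺ d∈S) }) (∈-verts⁺ c∈S)) })
      (∈-verts⁺ b∈S)) }) (∈-verts⁺ a∈S))

  ∈-quads⁻ : ∀ {a b c d} → (a , b , c , d) ∈ₗ quads S → a ∈ S × b ∈ S × c ∈ S × d ∈ S
  ∈-quads⁻ q∈ with find (∈-concatMap⁻ _ {xs = verts S} q∈)
  ... | _ , a∈ , q∈₁ with find (∈-concatMap⁻ _ {xs = verts S} q∈₁)
  ... | _ , b∈ , q∈₂ with find (∈-concatMap⁻ _ {xs = verts S} q∈₂)
  ... | _ , c∈ , q∈₃ with ∈-map⁻ _ q∈₃
  ... | _ , d∈ , refl = ∈-verts⁻ a∈ , ∈-verts⁻ b∈ , ∈-verts⁻ c∈ , ∈-verts⁻ d∈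

SwitchIn : ∀ {n} → Subset n → Graph n → Fin n → Fin n → Fin n → Fin n → Set
SwitchIn S G a b c d = ValidSwitch G a b c d × a ∈ S × b ∈ S × c ∈ S × d ∈ S

module _ {n} (S : Subset n) (G : Graph n) where

  ∈-switchResults⁺ : ∀ {a b c d} → SwitchIn S G a b c d →
    restrict S (switch G a b c d) ∈ₗ switchResults S G
  ∈-switchResults⁺ (valid , a∈S , b∈S , c∈S , d∈S) =
    ∈-map⁺ _ (∈-filter⁺ _ (∈-quads⁺ S a∈S b∈S c∈S d∈S) valid)

  ∈-switchResults⁻ : ∀ {r} → r ∈ₗ switchResults S G →
    ∃[ a ] ∃[ b ] ∃[ c ] ∃[ d ] SwitchIn S G a b c d × r ≡ restrict S (switch G a b c d)
  ∈-switchResults⁻ r∈ with ∈-map⁻ _ r∈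
  ... | (a , b , c , d) , q∈ , refl with ∈-filter⁻ _ {xs = quads S} q∈
  ... | q∈quads , valid with ∈-quads⁻ S q∈quads
  ... | a∈S , b∈S , c∈S , d∈S = a , b , c , d , (valid , a∈S , b∈S , c∈S , d∈S) , refl

map-≡⇒≡-on-∈ : ∀ {A B : Set} {f g : A → B} {xs} → map f xs ≡ map g xs →
  ∀ {z} → z ∈ₗ xs → f z ≡ g z
map-≡⇒≡-on-∈ {xs = _ ∷ _} eq (here refl) = let fz≡gz , _ = ∷-injective eq in fz≡gz
map-≡⇒≡-on-∈ {xs = _ ∷ _} eq (there z∈) = let _ , eq′ = ∷-injective eq in map-≡⇒≡-on-∈ eq′ z∈

restrict-⊤-injective : ∀ {n} {H H' : Adj n} → restrict ⊤ H ≡ restrict ⊤ H' → ∀ x y → H x y ≡ H' x y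
restrict-⊤-injective eq x y = map-≡⇒≡-on-∈ eq (∈-pairs⁺ ⊤ ∈⊤ ∈⊤)

restrict-⊤⇒restrict : ∀ {n} (S : Subset n) {H H' : Adj n} →
  restrict ⊤ H ≡ restrict ⊤ H' → restrict S H ≡ restrict S H'
restrict-⊤⇒restrict S eq = map-cong (λ { (x , y) → restrict-⊤-injective eq x y }) (pairs S)

if-true : ∀ {A : Set} {b} {x y : A} → b ≡ true → (if b then x else y) ≡ x
if-true refl = refl

if-false : ∀ {A : Set} {b} {x y : A} → b ≡ false → (if b then x else y) ≡ y
if-false refl = refl

samePair-refl : ∀ {n} (a b : Fin n) → samePair a b a b ≡ true
samePair-refl a b with a ≟ᶠ a | b ≟ᶠ b
... | yes _ | yes _  = refl
... | no a≢a | _     = contradiction refl a≢a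
... | yes _ | no b≢b = contradiction refl b≢b

≢⇒≟-false : ∀ {n} {x p : Fin n} → x ≢ p → ⌊ x ≟ᶠ p ⌋ ≡ false
≢⇒≟-false {x = x} {p} x≢p with x ≟ᶠ p
... | yes x≡p = contradiction x≡p x≢p
... | no _    = refl

module _ {n} {S : Subset n} where

  ∉-∈⇒≢ : ∀ {x p} → x ∉ S → p ∈ S → x ≢ p
  ∉-∈⇒≢ x∉S p∈S refl = x∉S p∈S

  samePair-outside : ∀ {x y p q} → x ∉ S ⊎ y ∉ S → p ∈ S → q ∈ S → samePair x y p q ≡ false
  samePair-outside (inj₁ x∉S) p∈S q∈S
    rewrite ≢⇒≟-false (∉-∈⇒≢ x∉S p∈S) | ≢⇒≟-false (∉-∈⇒≢ x∉S q∈S) = refl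
  samePair-outside {x} {p = p} {q} (inj₂ y∉S) p∈S q∈S
    rewrite ≢⇒≟-false (∉-∈⇒≢ y∉S p∈S) | ≢⇒≟-false (∉-∈⇒≢ y∉S q∈S) =
    cong₂ _∨_ (∧-zeroʳ ⌊ x ≟ᶠ p ⌋) (∧-zeroʳ ⌊ x ≟ᶠ q ⌋)

  switch-outside : ∀ (G : Graph n) {a b c d x y} → x ∉ S ⊎ y ∉ S →
    a ∈ S → b ∈ S → c ∈ S → d ∈ S → switch G a b c d x y ≡ adj G x y
  switch-outside G out a∈S b∈S c∈S d∈S = trans
    (if-false (cong₂ _∨_ (samePair-outside out a∈S b∈S) (samePair-outside out c∈S d∈S)))
    (if-false (cong₂ _∨_ (samePair-outside out a∈S c∈S) (samePair-outside out b∈S d∈S)))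

switch-removes-ab : ∀ {n} (G : Graph n) a b c d → switch G a b c d a b ≡ false
switch-removes-ab G a b c d = if-true (cong (_∨ samePair a b c d) (samePair-refl a b))

switch-removes-cd : ∀ {n} (G : Graph n) a b c d → switch G a b c d c d ≡ false
switch-removes-cd G a b c d =
  if-true (trans (cong (samePair c d a b ∨_) (samePair-refl c d)) (∨-zeroʳ _))

Involves : ∀ {n} → Fin n → Fin n → Fin n → Fin n → Fin n → Set
Involves v a b c d = v ≡ a ⊎ v ≡ b ⊎ v ≡ c ⊎ v ≡ d

module _ {n} (G : Graph n) (S : Subset n) where

  LiftsTo : List Bool → List Bool → Set
  LiftsTo r t = ∃[ a ] ∃[ b ] ∃[ c ] ∃[ d ]
    SwitchIn S G a b c d × r ≡ restrict S (switch G a b c d) × t ≡ restrict ⊤ (switch G a b c d)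

  LiftsTo-functionalˡ : ∀ {r r' t} → LiftsTo r t → LiftsTo r' t → r ≡ r'
  LiftsTo-functionalˡ (_ , _ , _ , _ , _ , r≡ , t≡) (_ , _ , _ , _ , _ , r'≡ , t≡') =
    trans r≡ (trans (restrict-⊤⇒restrict S (trans (sym t≡) t≡')) (sym r'≡))

  removing-edge-outside⇒degInduced<deg : ∀ {a b c d x y} → ValidSwitch G a b c d →
    x ∉ S ⊎ y ∉ S → adj G x y ≡ true → switch G a b c d x y ≡ false → degInduced S G < deg G
  removing-edge-outside⇒degInduced<deg {a} {b} {c} {d} {x} {y} valid out xy∈E xy∉E′ =
    unique-lifted-length< LiftsTo LiftsTo-functionalˡ
      (deduplicate-! _≟_ (switchResults S G)) (All.tabulate lift) σ∈ (All.tabulate σ-unlifted)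
    where
    _≟_ = ≡-dec _≟ᵇ_

    ∈-results-of-G : ∀ {a b c d} → ValidSwitch G a b c d →
      restrict ⊤ (switch G a b c d) ∈ₗ deduplicate _≟_ (switchResults ⊤ G)
    ∈-results-of-G valid′ = ∈-deduplicate⁺ _≟_ (∈-switchResults⁺ ⊤ G (valid′ , ∈⊤ , ∈⊤ , ∈⊤ , ∈⊤))

    σ∈ : restrict ⊤ (switch G a b c d) ∈ₗ deduplicate _≟_ (switchResults ⊤ G)
    σ∈ = ∈-results-of-G valid

    lift : ∀ {r} → r ∈ₗ deduplicate _≟_ (switchResults S G) →
      Lifted LiftsTo (deduplicate _≟_ (switchResults ⊤ G)) r
    lift r∈ with ∈-switchResults⁻ S G (∈-deduplicate⁻ _≟_ _ r∈)
    ... | a' , b' , c' , d' , sw@(valid′ , _) , r≡ =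
      restrict ⊤ (switch G a' b' c' d') , ∈-results-of-G valid′ , a' , b' , c' , d' , sw , r≡ , refl

    σ-unlifted : ∀ {r} → r ∈ₗ deduplicate _≟_ (switchResults S G) →
      ¬ LiftsTo r (restrict ⊤ (switch G a b c d))
    σ-unlifted _ (_ , _ , _ , _ , (_ , a'∈S , b'∈S , c'∈S , d'∈S) , _ , σ≡) = contradiction
      (begin
        false                ≡⟨ sym xy∉E′ ⟩
        switch G a b c d x y ≡⟨ restrict-⊤-injective σ≡ x y ⟩
        switch G _ _ _ _ x y ≡⟨ switch-outside G out a'∈S b'∈S c'∈S d'∈S ⟩
        adj G x y            ≡⟨ xy∈E ⟩
        true                 ∎)
      λ ()
      where open ≡-Reasoning

  involved-outside⇒degInduced<deg : ∀ {v a b c d} → ValidSwitch G a b c d →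
    Involves v a b c d → v ∉ S → degInduced S G < deg G
  involved-outside⇒degInduced<deg {a = a} {b} {c} {d} valid@(_ , _ , _ , _ , _ , _ , ab∈E , cd∈E , _)
    v-involved v∉S with v-involved
  ... | inj₁ refl =
    removing-edge-outside⇒degInduced<deg valid (inj₁ v∉S) ab∈E (switch-removes-ab G a b c d)
  ... | inj₂ (inj₁ refl) =
    removing-edge-outside⇒degInduced<deg valid (inj₂ v∉S) ab∈E (switch-removes-ab G a b c d)
  ... | inj₂ (inj₂ (inj₁ refl)) =
    removing-edge-outside⇒degInduced<deg valid (inj₁ v∉S) cd∈E (switch-removes-cd G a b c d)
  ... | inj₂ (inj₂ (inj₂ refl)) =
    removing-edge-outside⇒degInduced<deg valid (inj₂ v∉S) cd∈E (switch-removes-cd G a b c d)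

module _ {n} (G : Graph n) where

  injective⇒validSwitch : ∀ {w : Fin 4 → Fin n} → Injective _≡_ _≡_ w →
    adj G (w (# 0)) (w (# 1)) ≡ true → adj G (w (# 2)) (w (# 3)) ≡ true →
    adj G (w (# 0)) (w (# 2)) ≡ false → adj G (w (# 1)) (w (# 3)) ≡ false →
    ValidSwitch G (w (# 0)) (w (# 1)) (w (# 2)) (w (# 3))
  injective⇒validSwitch {w} w-inj e₀₁ e₂₃ n₀₂ n₁₃ =
    w≢ (λ ()) , w≢ (λ ()) , w≢ (λ ()) , w≢ (λ ()) , w≢ (λ ()) , w≢ (λ ()) , e₀₁ , e₂₃ , n₀₂ , n₁₃
    where
    w≢ : ∀ {i j} → i ≢ j → w i ≢ w j
    w≢ i≢j = i≢j ∘ w-inj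

  induced-pattern⇒validSwitch : ∀ {w : Fin 4 → Fin n} → Injective _≡_ _≡_ w →
    InducesVia G w P4 ⊎ InducesVia G w C4 ⊎ InducesVia G w 2K2 →
    ValidSwitch G (w (# 0)) (w (# 1)) (w (# 2)) (w (# 3))
  induced-pattern⇒validSwitch w-inj (inj₁ ind) =
    injective⇒validSwitch w-inj (ind _ _) (ind _ _) (ind _ _) (ind _ _)
  induced-pattern⇒validSwitch w-inj (inj₂ (inj₁ ind)) =
    injective⇒validSwitch w-inj (ind _ _) (ind _ _) (ind _ _) (ind _ _)
  induced-pattern⇒validSwitch w-inj (inj₂ (inj₂ ind)) =
    injective⇒validSwitch w-inj (ind _ _) (ind _ _) (ind _ _) (ind _ _)

  active⇒involved : ∀ {v} → Active G v →
    ∃[ a ] ∃[ b ] ∃[ c ] ∃[ d ] ValidSwitch G a b c d × Involves v a b c d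
  active⇒involved (w , w-inj , (k , refl) , induced) =
    w (# 0) , w (# 1) , w (# 2) , w (# 3) , induced-pattern⇒validSwitch w-inj induced , involved k
    where
    involved : ∀ k → Involves (w k) (w (# 0)) (w (# 1)) (w (# 2)) (w (# 3))
    involved zero                   = inj₁ refl
    involved (suc zero)             = inj₂ (inj₁ refl)
    involved (suc (suc zero))       = inj₂ (inj₂ (inj₁ refl))
    involved (suc (suc (suc zero))) = inj₂ (inj₂ (inj₂ refl))

mainTheorem17 : ∀ {n : ℕ} (G : Graph n) (S : Subset n) →
    (∀ v → v ∈ S → Active G v) →
    degInduced S G ≡ deg G →
    0 < deg G →
    ∀ v → Active G v → v ∈ S
mainTheorem17 G S _ deg-equal _ v v-active with v ∈? S
... | yes v∈S = v∈S
... | no v∉S  =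
  let _ , _ , _ , _ , valid , v-involved = active⇒involved G v-active
  in contradiction deg-equal (<⇒≢ (involved-outside⇒degInduced<deg G S valid v-involved v∉S))
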